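{- Let $C_{11}(\{1,3\})$ be the graph with vertex set $\{0,1,\dots,10\}$ in which distinct $i,j$ are adjacent iff $i-j\equiv\pm1$ or $\pm3\pmod{11}$. Then $\overline{L(C_{11}(\{1,3\}))}$ is a strongly equistable graph that is not a general partition graph.
   Context: $L(G)$ is the line graph of $G$ and $\overline{H}$ the complement of $H$. For a graph $H$, $\mathcal{S}(H)$ is the set of maximal stable sets and $\mathcal{T}(H)$ the set of other nonempty subsets of $V(H)$; $H$ is strongly equistable if for each $T\in\mathcal{T}(H)$ and each real $\gamma\le1$ there is $\varphi:V(H)\to\mathbb{R}_{>0}$ with $\varphi(S)=1$ for all $S\in\mathcal{S}(H)$ and $\varphi(T)\ne\gamma$, where $\varphi(X)=\sum_{x\in X}\varphi(x)$. $H$ is a general partition graph if there exist a set $U$ and non-empty subsets $U_x\subseteq U$ ($x\in V(H)$) such that $x,y$ are adjacent iff $U_x\cap U_y\neq\emptyset$, and for every maximal stable set $S$ of $H$, $\{U_x:x\in S\}$ is a partition of $U$.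
   Formalization: The parameter γ ranges over the rationals instead of the reals, and the weights φ take values in the positive rationals rather than the positive reals. -}

module Defs where

open import Level using (0ℓ)
open import Data.Bool using (Bool; true; false; _∧_; not; if_then_else_; T)
open import Data.Nat using (ℕ; zero; suc; _<ᵇ_; _≡ᵇ_)
import Data.Nat as ℕ
open import Data.Nat.DivMod using (_%_)
open import Data.Fin using (Fin; toℕ; _≟_)
open import Data.Fin.Properties using () renaming (_≟_ to _≟F_)
open import Data.List using (List; []; _∷_; length; lookup; filter; concatMap; allFin; map)
open import Data.Product using (Σ; ∃; _×_; _,_; proj₁; proj₂)
open import Data.Empty using (⊥)
open import Relation.Nullary using (¬_; does)
open import Relation.Binary.PropositionalEquality using (_≡_; _≢_)
open import Data.Rational using (ℚ; 0ℚ; 1ℚ; _+_; _≤_; _<_)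

-- A (simple, finite) graph on vertex set Fin n, given by a Boolean
-- adjacency function (assumed symmetric and irreflexive for the graphs we build).
Graph : ℕ → Set
Graph n = Fin n → Fin n → Bool

Subset : ℕ → Set
Subset n = Fin n → Bool

_∈S_ : ∀ {n} → Fin n → Subset n → Set
x ∈S X = T (X x)

diff11 : Fin 11 → Fin 11 → ℕ
diff11 i j = (toℕ i ℕ.+ 11 ℕ.∸ toℕ j) % 11

C11-13 : Graph 11
C11-13 i j = let d = diff11 i j in
  (d ≡ᵇ 1) Data.Bool.∨ (d ≡ᵇ 3) Data.Bool.∨ (d ≡ᵇ 8) Data.Bool.∨ (d ≡ᵇ 10)

-- Line graph: vertices are the edges {i,j} (listed with i < j) of G;
-- two distinct edges are adjacent iff they share an endpoint.

edgeList : ∀ {n} → Graph n → List (Fin n × Fin n)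
edgeList {n} G =
  concatMap (λ i → map (λ j → (i , j))
                        (filter (λ j → Data.Bool._≟_ ((toℕ i <ᵇ toℕ j) ∧ G i j) true)
                                (allFin n)))
            (allFin n)

eqᵇ : ∀ {n} → Fin n → Fin n → Bool
eqᵇ x y = does (x ≟F y)

shareEnd : ∀ {n} → Fin n × Fin n → Fin n × Fin n → Bool
shareEnd (a , b) (c , d) =
  eqᵇ a c Data.Bool.∨ eqᵇ a d Data.Bool.∨ eqᵇ b c Data.Bool.∨ eqᵇ b d

LineGraph : ∀ {n} → (G : Graph n) → Graph (length (edgeList G))
LineGraph G e f = not (eqᵇ e f) ∧ shareEnd (lookup (edgeList G) e) (lookup (edgeList G) f)

Complement : ∀ {n} → Graph n → Graph n
Complement G x y = not (eqᵇ x y) ∧ not (G x y)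

Stable : ∀ {n} → Graph n → Subset n → Set
Stable G S = ∀ x y → x ∈S S → y ∈S S → ¬ T (G x y)

MaximalStable : ∀ {n} → Graph n → Subset n → Set
MaximalStable {n} G S =
  Stable G S ×
  (∀ (S' : Subset n) → Stable G S' → (∀ x → x ∈S S → x ∈S S') → ∀ x → x ∈S S' → x ∈S S)

Nonempty : ∀ {n} → Subset n → Set
Nonempty X = ∃ λ x → x ∈S X

sumFin : ∀ {n} → (Fin n → ℚ) → ℚ
sumFin {zero}  f = 0ℚ
sumFin {suc n} f = f Data.Fin.zero + sumFin (λ i → f (Data.Fin.suc i))

weight : ∀ {n} → (Fin n → ℚ) → Subset n → ℚ
weight φ X = sumFin (λ x → if X x then φ x else 0ℚ)

StronglyEquistable : ∀ {n} → Graph n → Set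
StronglyEquistable {n} H =
  ∀ (X : Subset n) → Nonempty X → ¬ MaximalStable H X →
  ∀ (γ : ℚ) → γ ≤ 1ℚ →
  ∃ λ (φ : Fin n → ℚ) →
    (∀ x → 0ℚ < φ x) ×
    (∀ S → MaximalStable H S → weight φ S ≡ 1ℚ) ×
    (weight φ X ≢ γ)

GeneralPartitionGraph : ∀ {n} → Graph n → Set₁
GeneralPartitionGraph {n} H =
  Σ Set λ U → Σ (Fin n → U → Set) λ Ux →
    (∀ x → ∃ λ u → Ux x u) ×
    (∀ x y → x ≢ y → (T (H x y) → ∃ λ u → Ux x u × Ux y u)
                    × ((∃ λ u → Ux x u × Ux y u) → T (H x y))) ×
    (∀ S → MaximalStable H S →
        (∀ u → ∃ λ x → x ∈S S × Ux x u) ×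
        (∀ x y u → x ∈S S → y ∈S S → Ux x u → Ux y u → x ≡ y))

{-# OPTIONS --safe #-}
-- For the triangle-free 4-regular graph G = C₁₁({1,3}), the maximal stable sets of the
-- complement of L(G) are exactly the eleven vertex stars.
--
-- Strong equistability: the constant weight 1/4, and eleven further weights obtained by
-- adding ±1/8 alternately around a 4-cycle of G, are all equal to 1 on every star.  A
-- non-star X with more than four edges has constant weight above 1 ≥ γ; any other one is
-- told apart from the constant weight by one of the eleven (an exhaustive check), so one
-- of the two values of X differs from γ.
--
-- Not a general partition graph: a point u of U lies in U_e for exactly one edge e of
-- each star, and these edges are pairwise adjacent in the complement, i.e. disjoint in G,
-- so they would form a perfect matching of G, impossible on eleven vertices.
module Submission where

open import Defs
open import Data.Product using (_×_)
open import Relation.Nullary using (¬_)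

open import Data.Bool using (Bool; true; false; T; not; _∧_; _∨_; if_then_else_)
open import Data.Bool.Properties using (T?; T-∧; T-∨; T-≡) renaming (_≟_ to _≟ᵇ_)
open import Data.Empty using (⊥-elim)
open import Data.Fin using (Fin; zero; suc; #_; _<?_)
open import Data.Fin.Permutation using (permutation)
open import Data.Fin.Properties using (all?; any?; <-cmp) renaming (_≟_ to _≟ᶠ_)
import Data.List as List
open import Data.Nat using (ℕ; zero; suc; _+_; _*_; _∸_; _≤_; _<_; _≤ᵇ_; _≤?_; z≤n; s≤s)
open import Data.Nat.Divisibility using (_∣_; divides; _∣?_)
import Data.Nat.Properties as ℕ
open import Data.Product using (∃; _,_; proj₁; proj₂)
import Data.Product.Properties as Product
open import Data.Rational using (ℚ; 0ℚ; 1ℚ) renaming (_+_ to _+ℚ_; _<_ to _<ℚ_; _≤_ to _≤ℚ_; _/_ to _/ℚ_)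
import Data.Rational.Properties as ℚ
import Data.Integer as ℤ
open import Data.Sum using (_⊎_; inj₁; inj₂; [_,_]′)
import Data.Sum as Sum
open import Data.Vec using (Vec; []; _∷_; lookup; tabulate; replicate)
import Data.Vec.Properties as Vec
open import Function using (_∘_; Equivalence)
open import Relation.Binary using (tri<; tri≈; tri>)
open import Relation.Binary.PropositionalEquality
  using (_≡_; _≢_; _≗_; refl; sym; trans; cong; cong₂; subst; module ≡-Reasoning)
open import Relation.Nullary using (Dec; yes; no; does)
open import Relation.Nullary.Decidable
  using (toWitness; toWitnessFalse; dec-true; dec-false; decidable-stable; ¬?; _×-dec_; _⊎-dec_; _→-dec_)
open import Relation.Unary using (Decidable)

import Algebra.Properties.CommutativeMonoid.Sum as CommutativeMonoidSum
open import Algebra.Properties.Monoid.Mult ℚ.+-0-monoid using () renaming (_×_ to _·_; ×-homo-+ to ·-homo-+)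

module ℕΣ = CommutativeMonoidSum ℕ.+-0-commutativeMonoid

open ≡-Reasoning

-- Fixed-point-free involutions

FixedPointFreeInvolution : ℕ → Set
FixedPointFreeInvolution n =
  ∃ λ (p : Fin n → Fin n) → (∀ v → p (p v) ≡ v) × (∀ v → p v ≢ v)

[_<_] : ∀ {n} → Fin n → Fin n → ℕ
[ a < b ] = if does (a <? b) then 1 else 0

[<]+[>]≡1 : ∀ {n} {a b : Fin n} → a ≢ b → [ a < b ] + [ b < a ] ≡ 1
[<]+[>]≡1 {a = a} {b} a≢b with <-cmp a b
... | tri< a<b _ b≮a rewrite dec-true (a <? b) a<b | dec-false (b <? a) b≮a = refl
... | tri≈ _ a≡b _ = ⊥-elim (a≢b a≡b)
... | tri> a≮b _ b<a rewrite dec-false (a <? b) a≮b | dec-true (b <? a) b<a = refl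

sum-ones : ∀ n → ℕΣ.sum {n} (λ _ → 1) ≡ n
sum-ones zero    = refl
sum-ones (suc n) = cong suc (sum-ones n)

-- Each orbit {v, p v} contains exactly one ascent, and p permutes the ascents.
fixedPointFreeInvolution⇒even : ∀ {n} → FixedPointFreeInvolution n → 2 ∣ n
fixedPointFreeInvolution⇒even {n} (p , p-inv , p-free) = divides s (begin
  n                                          ≡⟨ sym (sum-ones n) ⟩
  ℕΣ.sum {n} (λ _ → 1)                       ≡⟨ sym (ℕΣ.sum-cong-≗ orbit) ⟩
  ℕΣ.sum {n} (λ v → ascent v + ascent (p v)) ≡⟨ ℕΣ.∑-distrib-+ ascent (ascent ∘ p) ⟩
  s + ℕΣ.sum (ascent ∘ p)                    ≡⟨ cong (s +_) (sym (ℕΣ.sum-permute ascent π)) ⟩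
  s + s                                      ≡⟨ cong (s +_) (sym (ℕ.+-identityʳ s)) ⟩
  2 * s                                      ≡⟨ ℕ.*-comm 2 s ⟩
  s * 2                                      ∎)
  where
  ascent : Fin n → ℕ
  ascent v = [ v < p v ]
  s : ℕ
  s = ℕΣ.sum ascent
  π = permutation p p p-inv p-inv
  orbit : ∀ v → ascent v + ascent (p v) ≡ 1
  orbit v = trans (cong (λ w → ascent v + [ p v < w ]) (p-inv v)) ([<]+[>]≡1 (p-free v ∘ sym))

-- Stable sets

_⊆_ : ∀ {n} → Subset n → Subset n → Set
X ⊆ Y = ∀ x → x ∈S X → x ∈S Y

_≐_ : ∀ {n} → Graph n → Graph n → Set
G ≐ G′ = ∀ x y → G x y ≡ G′ x y

≐-sym : ∀ {n} {G G′ : Graph n} → G ≐ G′ → G′ ≐ G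
≐-sym G≐G′ x y = sym (G≐G′ x y)

T-extensional : ∀ {a b} → (T a → T b) → (T b → T a) → a ≡ b
T-extensional {false} {false} _ _ = refl
T-extensional {false} {true}  _ b⇒a = ⊥-elim (b⇒a _)
T-extensional {true}  {false} a⇒b _ = ⊥-elim (a⇒b _)
T-extensional {true}  {true}  _ _ = refl

⊆-or-escape : ∀ {n} (X Y : Subset n) → X ⊆ Y ⊎ ∃ λ x → x ∈S X × ¬ x ∈S Y
⊆-or-escape X Y with any? (λ x → T? (X x) ×-dec ¬? (T? (Y x)))
... | yes escape = inj₂ escape
... | no ¬escape = inj₁ λ x x∈X → decidable-stable (T? (Y x)) (λ x∉Y → ¬escape (x , x∈X , x∉Y))

Stable-resp-≐ : ∀ {n} {G G′ : Graph n} {S} → G ≐ G′ → Stable G S → Stable G′ S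
Stable-resp-≐ G≐G′ stable x y x∈S y∈S = stable x y x∈S y∈S ∘ subst T (sym (G≐G′ x y))

MaximalStable-resp-≐ : ∀ {n} {G G′ : Graph n} {S} → G ≐ G′ → MaximalStable G S → MaximalStable G′ S
MaximalStable-resp-≐ G≐G′ (stable , maximal) =
  Stable-resp-≐ G≐G′ stable , λ S′ → maximal S′ ∘ Stable-resp-≐ (≐-sym G≐G′)

MaximalStable-resp-≗ : ∀ {n} {G : Graph n} {S S′} → S ≗ S′ → MaximalStable G S → MaximalStable G S′
MaximalStable-resp-≗ {S = S} {S′} S≗S′ (stable , maximal) =
  (λ x y x∈S′ y∈S′ → stable x y (from x x∈S′) (from y y∈S′)) ,
  (λ R R-stable S′⊆R x x∈R → to x (maximal R R-stable (λ y → S′⊆R y ∘ to y) x x∈R))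
  where
  to : S ⊆ S′
  to x = subst T (S≗S′ x)
  from : S′ ⊆ S
  from x = subst T (sym (S≗S′ x))

stable-dominating⇒maximal : ∀ {n} {G : Graph n} {S} → Stable G S →
  (∀ x → ¬ x ∈S S → ∃ λ y → y ∈S S × T (G x y)) → MaximalStable G S
stable-dominating⇒maximal {S = S} stable dominating = stable , maximal
  where
  maximal : ∀ S′ → Stable _ S′ → S ⊆ S′ → S′ ⊆ S
  maximal S′ S′-stable S⊆S′ x x∈S′ with T? (S x)
  ... | yes x∈S = x∈S
  ... | no x∉S =
    let y , y∈S , x~y = dominating x x∉S in ⊥-elim (S′-stable x y x∈S′ (S⊆S′ y y∈S) x~y)

maximalStable-covered : ∀ {n} {G : Graph n} {I : Set} (F : I → Subset n) →
  (∀ i → Stable G (F i)) → (∀ S → Stable G S → ∃ λ i → S ⊆ F i) →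
  ∀ {S} → MaximalStable G S → ∃ λ i → S ≗ F i
maximalStable-covered F F-stable cover {S} (stable , maximal) =
  let i , S⊆Fi = cover S stable
      Fi⊆S = maximal (F i) (F-stable i) S⊆Fi
  in i , λ x → T-extensional (S⊆Fi x) (Fi⊆S x)

StrongClique : ∀ {n} → Graph n → (Fin n → Set) → Set
StrongClique G K =
  (∀ x y → x ≢ y → K x → K y → T (G x y)) ×
  (∀ S → MaximalStable G S → ∃ λ x → x ∈S S × K x)

generalPartition⇒strongClique : ∀ {n} {G : Graph n} → Fin n → GeneralPartitionGraph G →
  ∃ λ (K : Fin n → Set) → StrongClique G K
generalPartition⇒strongClique x₀ (U , Ux , nonempty , adjacency , partition) =
  (λ x → Ux x u) ,
  (λ x y x≢y u∈x u∈y → proj₂ (adjacency x y x≢y) (u , u∈x , u∈y)) ,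
  (λ S S-maximal → proj₁ (partition S S-maximal) u)
  where
  u = proj₁ (nonempty x₀)

GeneralPartitionGraph-resp-≐ : ∀ {n} {G G′ : Graph n} → G ≐ G′ →
  GeneralPartitionGraph G → GeneralPartitionGraph G′
GeneralPartitionGraph-resp-≐ G≐G′ (U , Ux , nonempty , adjacency , partition) =
  U , Ux , nonempty ,
  (λ x y x≢y → let to , from = adjacency x y x≢y
               in to ∘ subst T (sym (G≐G′ x y)) , subst T (G≐G′ x y) ∘ from) ,
  (λ S → partition S ∘ MaximalStable-resp-≐ (≐-sym G≐G′))

AdmissibleWeight : ∀ {n} → Graph n → (Fin n → ℚ) → Set
AdmissibleWeight G φ = (∀ x → 0ℚ <ℚ φ x) × (∀ S → MaximalStable G S → weight φ S ≡ 1ℚ)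

weight-cong : ∀ {n} (φ : Fin n → ℚ) {X Y : Subset n} → X ≗ Y → weight φ X ≡ weight φ Y
weight-cong {zero}  φ X≗Y = refl
weight-cong {suc n} φ X≗Y =
  cong₂ _+ℚ_ (cong (λ b → if b then φ zero else 0ℚ) (X≗Y zero)) (weight-cong (φ ∘ suc) (X≗Y ∘ suc))

stronglyEquistable-bySeparation : ∀ {n} {G : Graph n} (φ : Fin n → ℚ) → AdmissibleWeight G φ →
  (∀ X → Nonempty X → ¬ MaximalStable G X →
     1ℚ <ℚ weight φ X ⊎ ∃ λ ψ → AdmissibleWeight G ψ × weight ψ X ≢ weight φ X) →
  StronglyEquistable G
stronglyEquistable-bySeparation φ (φ-pos , φ-unit) separate X X-nonempty X-notMaximal γ γ≤1
  with separate X X-nonempty X-notMaximal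
... | inj₁ 1<φX = φ , φ-pos , φ-unit , λ φX≡γ →
  ℚ.<-irrefl refl (ℚ.<-≤-trans 1<φX (subst (_≤ℚ 1ℚ) (sym φX≡γ) γ≤1))
... | inj₂ (ψ , (ψ-pos , ψ-unit) , ψX≢φX) with weight φ X ℚ.≟ γ
...   | yes φX≡γ = ψ , ψ-pos , ψ-unit , λ ψX≡γ → ψX≢φX (trans ψX≡γ (sym φX≡γ))
...   | no φX≢γ = φ , φ-pos , φ-unit , φX≢γ

StronglyEquistable-resp-≐ : ∀ {n} {G G′ : Graph n} → G ≐ G′ → StronglyEquistable G → StronglyEquistable G′
StronglyEquistable-resp-≐ G≐G′ equistable X X-nonempty X-notMaximal γ γ≤1 =
  let φ , φ-pos , φ-unit , φX≢γ = equistable X X-nonempty (X-notMaximal ∘ MaximalStable-resp-≐ G≐G′) γ γ≤1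
  in φ , φ-pos , (λ S → φ-unit S ∘ MaximalStable-resp-≐ (≐-sym G≐G′)) , φX≢γ

-- Weights in eighths

⅛ : ℚ
⅛ = ℤ.+ 1 /ℚ 8

0<⅛ : 0ℚ <ℚ ⅛
0<⅛ = toWitness {a? = 0ℚ ℚ.<? ⅛} _

·-nonNeg : ∀ {x} → 0ℚ ≤ℚ x → ∀ n → 0ℚ ≤ℚ n · x
·-nonNeg 0≤x zero    = ℚ.≤-refl
·-nonNeg 0≤x (suc n) = ℚ.+-mono-≤ 0≤x (·-nonNeg 0≤x n)

·-monoˡ-< : ∀ {x} → 0ℚ <ℚ x → ∀ {m n} → m < n → m · x <ℚ n · x
·-monoˡ-<     0<x {zero}  {suc n} _         = ℚ.+-mono-<-≤ 0<x (·-nonNeg (ℚ.<⇒≤ 0<x) n)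
·-monoˡ-< {x} 0<x {suc m} {suc n} (s≤s m<n) = ℚ.+-monoʳ-< x (·-monoˡ-< 0<x m<n)

·-cancelʳ : ∀ {x} → 0ℚ <ℚ x → ∀ {m n} → m · x ≡ n · x → m ≡ n
·-cancelʳ 0<x {m} {n} eq with ℕ.<-cmp m n
... | tri< m<n _ _ = ⊥-elim (ℚ.<⇒≢ (·-monoˡ-< 0<x m<n) eq)
... | tri≈ _ m≡n _ = m≡n
... | tri> _ _ n<m = ⊥-elim (ℚ.<⇒≢ (·-monoˡ-< 0<x n<m) (sym eq))

mass : ∀ {n} → Vec ℕ n → Vec Bool n → ℕ
mass []       []       = 0
mass (w ∷ ws) (b ∷ bs) = (if b then w else 0) + mass ws bs

eighths : ∀ {n} → Vec ℕ n → Fin n → ℚ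
eighths w x = lookup w x · ⅛

weight-eighths : ∀ {n} (w : Vec ℕ n) (X : Subset n) → weight (eighths w) X ≡ mass w (tabulate X) · ⅛
weight-eighths []       X = refl
weight-eighths (w ∷ ws) X = begin
  (if X zero then w · ⅛ else 0ℚ) +ℚ weight (eighths ws) (X ∘ suc)
    ≡⟨ cong₂ _+ℚ_ (if-· (X zero)) (weight-eighths ws (X ∘ suc)) ⟩
  (if X zero then w else 0) · ⅛ +ℚ mass ws (tabulate (X ∘ suc)) · ⅛
    ≡⟨ sym (·-homo-+ ⅛ (if X zero then w else 0) _) ⟩
  mass (w ∷ ws) (tabulate X) · ⅛ ∎
  where
  if-· : ∀ b → (if b then w · ⅛ else 0ℚ) ≡ (if b then w else 0) · ⅛
  if-· true  = refl
  if-· false = refl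

eighths-positive : ∀ {n} (w : Vec ℕ n) → (∀ x → 0 < lookup w x) → ∀ x → 0ℚ <ℚ eighths w x
eighths-positive w w-pos x = ·-monoˡ-< 0<⅛ (w-pos x)

tabulate-injective : ∀ {n} {X Y : Subset n} → tabulate X ≡ tabulate Y → X ≗ Y
tabulate-injective {X = X} {Y} eq x = begin
  X x                    ≡⟨ sym (Vec.lookup∘tabulate X x) ⟩
  lookup (tabulate X) x  ≡⟨ cong (λ v → lookup v x) eq ⟩
  lookup (tabulate Y) x  ≡⟨ Vec.lookup∘tabulate Y x ⟩
  Y x                    ∎

allWithin : ∀ {n} → Vec ℕ n → ℕ → (Vec Bool n → Bool) → Bool
allWithin []       B p = p []
allWithin (w ∷ ws) B p =
  allWithin ws B (p ∘ (false ∷_)) ∧ (if w ≤ᵇ B then allWithin ws (B ∸ w) (p ∘ (true ∷_)) else true)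

allWithin-sound : ∀ {n} (ws : Vec ℕ n) B p → T (allWithin ws B p) → ∀ v → mass ws v ≤ B → T (p v)
allWithin-sound []       B p t [] _ = t
allWithin-sound (w ∷ ws) B p t (false ∷ v) m≤B =
  allWithin-sound ws B (p ∘ (false ∷_)) (proj₁ (Equivalence.to T-∧ t)) v m≤B
allWithin-sound (w ∷ ws) B p t (true ∷ v) m≤B
  with w ≤ᵇ B | ℕ.≤⇒≤ᵇ (ℕ.m+n≤o⇒m≤o w m≤B)
... | true | _ =
  allWithin-sound ws (B ∸ w) (p ∘ (true ∷_)) (proj₂ (Equivalence.to T-∧ t)) v
    (ℕ.m+n≤o⇒m≤o∸n (mass ws v) (subst (_≤ B) (ℕ.+-comm w (mass ws v)) m≤B))

-- Complements of line graphs

incident : ∀ {n} → Fin n → Fin n × Fin n → Bool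
incident v (a , b) = eqᵇ v a ∨ eqᵇ v b

does⇒ : ∀ {A : Set} (d : Dec A) → T (does d) → A
does⇒ (yes a) _ = a

incident-view : ∀ {n} {v : Fin n} {a b} → T (incident v (a , b)) → v ≡ a ⊎ v ≡ b
incident-view {v = v} {a} {b} = Sum.map (does⇒ (v ≟ᶠ a)) (does⇒ (v ≟ᶠ b)) ∘ Equivalence.to T-∨

T-∨ˡ : ∀ {a b} → T a → T (a ∨ b)
T-∨ˡ = Equivalence.from T-∨ ∘ inj₁

T-∨ʳ : ∀ {a b} → T b → T (a ∨ b)
T-∨ʳ = Equivalence.from T-∨ ∘ inj₂

eqᵇ-refl : ∀ {n} (v : Fin n) → T (eqᵇ v v)
eqᵇ-refl v = Equivalence.from T-≡ (dec-true (v ≟ᶠ v) refl)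

shareEnd-incident : ∀ {n} {v : Fin n} p q → T (incident v p) → T (incident v q) → T (shareEnd p q)
shareEnd-incident {v = v} (a , b) (c , d) v∈p v∈q
  with incident-view {v = v} {a} {b} v∈p | incident-view {v = v} {c} {d} v∈q
... | inj₁ refl | inj₁ refl = T-∨ˡ {eqᵇ v v} (eqᵇ-refl v)
... | inj₁ refl | inj₂ refl = T-∨ʳ {eqᵇ v c} (T-∨ˡ {eqᵇ v v} (eqᵇ-refl v))
... | inj₂ refl | inj₁ refl = T-∨ʳ {eqᵇ a v} (T-∨ʳ {eqᵇ a d} (T-∨ˡ {eqᵇ v v} (eqᵇ-refl v)))
... | inj₂ refl | inj₂ refl = T-∨ʳ {eqᵇ a c} (T-∨ʳ {eqᵇ a v} (T-∨ʳ {eqᵇ v c} (eqᵇ-refl v)))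

opposite : ∀ {n} → Fin n × Fin n → Fin n → Fin n
opposite (a , b) v with v ≟ᶠ a
... | yes _ = b
... | no  _ = a

module _ {n} {a b v : Fin n} (a≢b : a ≢ b) (v∈ab : T (incident v (a , b))) where

  opposite-incident : T (incident (opposite (a , b) v) (a , b))
  opposite-incident with v ≟ᶠ a
  ... | yes _ = T-∨ʳ (eqᵇ-refl b)
  ... | no  _ = T-∨ˡ (eqᵇ-refl a)

  opposite-≢ : opposite (a , b) v ≢ v
  opposite-≢ with v ≟ᶠ a | incident-view {v = v} v∈ab
  ... | yes refl | _        = a≢b ∘ sym
  ... | no  v≢a  | inj₁ v≡a = ⊥-elim (v≢a v≡a)
  ... | no  _    | inj₂ refl = a≢b

  opposite-involutive : opposite (a , b) (opposite (a , b) v) ≡ v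
  opposite-involutive with v ≟ᶠ a | incident-view {v = v} v∈ab
  ... | yes refl | _ with b ≟ᶠ v
  ...   | yes b≡v = ⊥-elim (a≢b (sym b≡v))
  ...   | no  _   = refl
  opposite-involutive | no v≢a | inj₁ v≡a = ⊥-elim (v≢a v≡a)
  opposite-involutive | no _   | inj₂ refl with a ≟ᶠ a
  ...   | yes _   = refl
  ...   | no  a≢a = ⊥-elim (a≢a refl)

-- Defs' LineGraph G is the line graph for ends = List.lookup (edgeList G).
module LineGraphComplement {m n} (ends : Fin m → Fin n × Fin n) where

  Lᶜ : Graph m
  Lᶜ = Complement (λ e f → not (eqᵇ e f) ∧ shareEnd (ends e) (ends f))

  Star : Fin n → Subset m
  Star v e = incident v (ends e)

  Loopless : Set
  Loopless = ∀ e → proj₁ (ends e) ≢ proj₂ (ends e)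

  -- For e = ab, pairwise intersecting edges f ∌ a and g ∌ b would be bc and ac:
  -- this is triangle-freeness of the underlying graph.
  TriangleFree : Set
  TriangleFree = ∀ e f g → ¬ T (Lᶜ e f) → ¬ T (Lᶜ e g) → ¬ T (Lᶜ f g) →
                 f ∈S Star (proj₁ (ends e)) ⊎ g ∈S Star (proj₂ (ends e))

  star-stable : ∀ v → Stable Lᶜ (Star v)
  star-stable v e f e∈v f∈v = not-adjacent (eqᵇ e f) (shareEnd-incident {v = v} (ends e) (ends f) e∈v f∈v)
    where
    not-adjacent : ∀ b {s} → T s → ¬ T (not b ∧ not (not b ∧ s))
    not-adjacent true  _ ()
    not-adjacent false {true} _ ()

  stable⊆star : TriangleFree → Fin n → ∀ {S} → Stable Lᶜ S → ∃ λ v → S ⊆ Star v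
  stable⊆star triangleFree v₀ {S} stable with any? (T? ∘ S)
  ... | no S-empty = v₀ , λ e e∈S → ⊥-elim (S-empty (e , e∈S))
  ... | yes (e , e∈S)
    with ⊆-or-escape S (Star (proj₁ (ends e))) | ⊆-or-escape S (Star (proj₂ (ends e)))
  ...   | inj₁ S⊆a | _        = proj₁ (ends e) , S⊆a
  ...   | inj₂ _   | inj₁ S⊆b = proj₂ (ends e) , S⊆b
  ...   | inj₂ (f , f∈S , f∉a) | inj₂ (g , g∈S , g∉b) =
    ⊥-elim ([ f∉a , g∉b ]′
      (triangleFree e f g (stable e f e∈S f∈S) (stable e g e∈S g∈S) (stable f g f∈S g∈S)))

  -- A strong clique of Lᶜ is a perfect matching: its edge at v is also its edge at the other end.
  strongClique⇒fixedPointFreeInvolution : Loopless → (∀ v → MaximalStable Lᶜ (Star v)) →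
    ∀ {K} → StrongClique Lᶜ K → FixedPointFreeInvolution n
  strongClique⇒fixedPointFreeInvolution loopless star-maximal {K} (clique , meets) = p , p-inv , p-free
    where
    edge : Fin n → Fin m
    edge v = proj₁ (meets (Star v) (star-maximal v))
    edge-at : ∀ v → edge v ∈S Star v
    edge-at v = proj₁ (proj₂ (meets (Star v) (star-maximal v)))
    edge-in : ∀ v → K (edge v)
    edge-in v = proj₂ (proj₂ (meets (Star v) (star-maximal v)))
    p : Fin n → Fin n
    p v = opposite (ends (edge v)) v
    edge-p : ∀ v → edge (p v) ≡ edge v
    edge-p v with edge (p v) ≟ᶠ edge v
    ... | yes same = same
    ... | no differ = ⊥-elim (star-stable (p v) _ _ (edge-at (p v))
                               (opposite-incident {v = v} (loopless (edge v)) (edge-at v))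
                               (clique _ _ differ (edge-in (p v)) (edge-in v)))
    p-inv : ∀ v → p (p v) ≡ v
    p-inv v = begin
      opposite (ends (edge (p v))) (p v) ≡⟨ cong (λ e → opposite (ends e) (p v)) (edge-p v) ⟩
      opposite (ends (edge v)) (p v)     ≡⟨ opposite-involutive {v = v} (loopless (edge v)) (edge-at v) ⟩
      v                                  ∎
    p-free : ∀ v → p v ≢ v
    p-free v = opposite-≢ {v = v} (loopless (edge v)) (edge-at v)

-- The graph C₁₁({1,3})

-- A literal copy of edgeList C11-13, so that the decisions below do not recompute it.
endsTable : Vec (Fin 11 × Fin 11) 22
endsTable =
  (# 0 , # 1) ∷ (# 0 , # 3) ∷ (# 0 , # 8) ∷ (# 0 , # 10) ∷
  (# 1 , # 2) ∷ (# 1 , # 4) ∷ (# 1 , # 9) ∷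
  (# 2 , # 3) ∷ (# 2 , # 5) ∷ (# 2 , # 10) ∷
  (# 3 , # 4) ∷ (# 3 , # 6) ∷
  (# 4 , # 5) ∷ (# 4 , # 7) ∷
  (# 5 , # 6) ∷ (# 5 , # 8) ∷
  (# 6 , # 7) ∷ (# 6 , # 9) ∷
  (# 7 , # 8) ∷ (# 7 , # 10) ∷
  (# 8 , # 9) ∷
  (# 9 , # 10) ∷
  []

ends : Fin 22 → Fin 11 × Fin 11
ends = lookup endsTable

open LineGraphComplement ends

lookup-edgeList≡ends : ∀ e → List.lookup (edgeList C11-13) e ≡ ends e
lookup-edgeList≡ends = toWitness {a? = all? λ e →
  Product.≡-dec _≟ᶠ_ _≟ᶠ_ (List.lookup (edgeList C11-13) e) (ends e)} _

complement-lineGraph≐Lᶜ : Complement (LineGraph C11-13) ≐ Lᶜ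
complement-lineGraph≐Lᶜ e f =
  cong₂ (λ p q → not (eqᵇ e f) ∧ not (not (eqᵇ e f) ∧ shareEnd p q))
        (lookup-edgeList≡ends e) (lookup-edgeList≡ends f)

loopless : Loopless
loopless = toWitness {a? = all? λ e → ¬? (proj₁ (ends e) ≟ᶠ proj₂ (ends e))} _

star-dominating : ∀ v e → ¬ e ∈S Star v → ∃ λ f → f ∈S Star v × T (Lᶜ e f)
star-dominating = toWitness {a? = all? λ v → all? λ e →
  ¬? (T? (Star v e)) →-dec any? λ f → T? (Star v f) ×-dec T? (Lᶜ e f)} _

triangleFree : TriangleFree
triangleFree = toWitness {a? = all? λ e → all? λ f → all? λ g →
  ¬? (T? (Lᶜ e f)) →-dec ¬? (T? (Lᶜ e g)) →-dec ¬? (T? (Lᶜ f g)) →-dec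
  (T? (Star (proj₁ (ends e)) f) ⊎-dec T? (Star (proj₂ (ends e)) g))} _

star-maximal : ∀ v → MaximalStable Lᶜ (Star v)
star-maximal v = stable-dominating⇒maximal (star-stable v) (star-dominating v)

maximalStable≗star : ∀ {S} → MaximalStable Lᶜ S → ∃ λ v → S ≗ Star v
maximalStable≗star = maximalStable-covered Star star-stable (λ _ → stable⊆star triangleFree (# 0))

uniformWeight : Vec ℕ 22
uniformWeight = replicate 22 2

-- Row j is 2 changed by +1, -1, +1, -1 along the edges of the 4-cycle j, j+1, j+4, j+3
-- (indexed as in endsTable), so every star still has mass 8.
cycleWeights : Vec (Vec ℕ 22) 11
cycleWeights =
  (3 ∷ 1 ∷ 2 ∷ 2 ∷ 2 ∷ 1 ∷ 2 ∷ 2 ∷ 2 ∷ 2 ∷ 3 ∷ 2 ∷ 2 ∷ 2 ∷ 2 ∷ 2 ∷ 2 ∷ 2 ∷ 2 ∷ 2 ∷ 2 ∷ 2 ∷ []) ∷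
  (2 ∷ 2 ∷ 2 ∷ 2 ∷ 3 ∷ 1 ∷ 2 ∷ 2 ∷ 1 ∷ 2 ∷ 2 ∷ 2 ∷ 3 ∷ 2 ∷ 2 ∷ 2 ∷ 2 ∷ 2 ∷ 2 ∷ 2 ∷ 2 ∷ 2 ∷ []) ∷
  (2 ∷ 2 ∷ 2 ∷ 2 ∷ 2 ∷ 2 ∷ 2 ∷ 3 ∷ 1 ∷ 2 ∷ 2 ∷ 1 ∷ 2 ∷ 2 ∷ 3 ∷ 2 ∷ 2 ∷ 2 ∷ 2 ∷ 2 ∷ 2 ∷ 2 ∷ []) ∷
  (2 ∷ 2 ∷ 2 ∷ 2 ∷ 2 ∷ 2 ∷ 2 ∷ 2 ∷ 2 ∷ 2 ∷ 3 ∷ 1 ∷ 2 ∷ 1 ∷ 2 ∷ 2 ∷ 3 ∷ 2 ∷ 2 ∷ 2 ∷ 2 ∷ 2 ∷ []) ∷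
  (2 ∷ 2 ∷ 2 ∷ 2 ∷ 2 ∷ 2 ∷ 2 ∷ 2 ∷ 2 ∷ 2 ∷ 2 ∷ 2 ∷ 3 ∷ 1 ∷ 2 ∷ 1 ∷ 2 ∷ 2 ∷ 3 ∷ 2 ∷ 2 ∷ 2 ∷ []) ∷
  (2 ∷ 2 ∷ 2 ∷ 2 ∷ 2 ∷ 2 ∷ 2 ∷ 2 ∷ 2 ∷ 2 ∷ 2 ∷ 2 ∷ 2 ∷ 2 ∷ 3 ∷ 1 ∷ 2 ∷ 1 ∷ 2 ∷ 2 ∷ 3 ∷ 2 ∷ []) ∷
  (2 ∷ 2 ∷ 2 ∷ 2 ∷ 2 ∷ 2 ∷ 2 ∷ 2 ∷ 2 ∷ 2 ∷ 2 ∷ 2 ∷ 2 ∷ 2 ∷ 2 ∷ 2 ∷ 3 ∷ 1 ∷ 2 ∷ 1 ∷ 2 ∷ 3 ∷ []) ∷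
  (2 ∷ 2 ∷ 1 ∷ 3 ∷ 2 ∷ 2 ∷ 2 ∷ 2 ∷ 2 ∷ 2 ∷ 2 ∷ 2 ∷ 2 ∷ 2 ∷ 2 ∷ 2 ∷ 2 ∷ 2 ∷ 3 ∷ 1 ∷ 2 ∷ 2 ∷ []) ∷
  (3 ∷ 2 ∷ 1 ∷ 2 ∷ 2 ∷ 2 ∷ 1 ∷ 2 ∷ 2 ∷ 2 ∷ 2 ∷ 2 ∷ 2 ∷ 2 ∷ 2 ∷ 2 ∷ 2 ∷ 2 ∷ 2 ∷ 2 ∷ 3 ∷ 2 ∷ []) ∷
  (2 ∷ 2 ∷ 2 ∷ 2 ∷ 3 ∷ 2 ∷ 1 ∷ 2 ∷ 2 ∷ 1 ∷ 2 ∷ 2 ∷ 2 ∷ 2 ∷ 2 ∷ 2 ∷ 2 ∷ 2 ∷ 2 ∷ 2 ∷ 2 ∷ 3 ∷ []) ∷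
  (2 ∷ 1 ∷ 2 ∷ 3 ∷ 2 ∷ 2 ∷ 2 ∷ 3 ∷ 2 ∷ 1 ∷ 2 ∷ 2 ∷ 2 ∷ 2 ∷ 2 ∷ 2 ∷ 2 ∷ 2 ∷ 2 ∷ 2 ∷ 2 ∷ 2 ∷ []) ∷
  []

eighths-admissible : ∀ w → (∀ e → 0 < lookup w e) → (∀ v → mass w (tabulate (Star v)) ≡ 8) →
  AdmissibleWeight Lᶜ (eighths w)
eighths-admissible w w-pos star-mass = eighths-positive w w-pos , unit
  where
  unit : ∀ S → MaximalStable Lᶜ S → weight (eighths w) S ≡ 1ℚ
  unit S S-maximal = let v , S≗Star = maximalStable≗star S-maximal in begin
    weight (eighths w) S            ≡⟨ weight-cong (eighths w) S≗Star ⟩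
    weight (eighths w) (Star v)     ≡⟨ weight-eighths w (Star v) ⟩
    mass w (tabulate (Star v)) · ⅛  ≡⟨ cong (_· ⅛) (star-mass v) ⟩
    8 · ⅛                           ≡⟨⟩
    1ℚ                              ∎

uniform-admissible : AdmissibleWeight Lᶜ (eighths uniformWeight)
uniform-admissible = eighths-admissible uniformWeight
  (λ e → subst (0 <_) (sym (Vec.lookup-replicate e 2)) (s≤s z≤n))
  (toWitness {a? = all? λ v → mass uniformWeight (tabulate (Star v)) ℕ.≟ 8} _)

cycle-admissible : ∀ j → AdmissibleWeight Lᶜ (eighths (lookup cycleWeights j))
cycle-admissible j = eighths-admissible (lookup cycleWeights j)
  (toWitness {a? = all? λ j → all? λ e → 0 ℕ.<? lookup (lookup cycleWeights j) e} _ j)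
  (toWitness {a? = all? λ j → all? λ v → mass (lookup cycleWeights j) (tabulate (Star v)) ℕ.≟ 8} _ j)

Resolved : Vec Bool 22 → Set
Resolved v = (∃ λ j → mass (lookup cycleWeights j) v ≢ mass uniformWeight v)
           ⊎ (∃ λ k → v ≡ tabulate (Star k))
           ⊎ v ≡ tabulate (λ _ → false)

resolved? : Decidable Resolved
resolved? v = any? (λ j → ¬? (mass (lookup cycleWeights j) v ℕ.≟ mass uniformWeight v))
         ⊎-dec any? (λ k → Vec.≡-dec _≟ᵇ_ v (tabulate (Star k)))
         ⊎-dec Vec.≡-dec _≟ᵇ_ v (tabulate (λ _ → false))

-- A mass of at most 8 under uniformWeight means at most four edges.
small-resolved : ∀ v → mass uniformWeight v ≤ 8 → Resolved v
small-resolved v small = does⇒ (resolved? v) (allWithin-sound uniformWeight 8 (does ∘ resolved?) _ v small)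

separation : ∀ X → Nonempty X → ¬ MaximalStable Lᶜ X →
  1ℚ <ℚ weight (eighths uniformWeight) X ⊎
  ∃ λ ψ → AdmissibleWeight Lᶜ ψ × weight ψ X ≢ weight (eighths uniformWeight) X
separation X (x , x∈X) X-notMaximal with mass uniformWeight (tabulate X) ≤? 8
... | no large = inj₁ (subst (1ℚ <ℚ_) (sym (weight-eighths uniformWeight X)) (·-monoˡ-< 0<⅛ (ℕ.≰⇒> large)))
... | yes small with small-resolved (tabulate X) small
...   | inj₁ (j , differ) = inj₂ (eighths w , cycle-admissible j , λ same → differ (·-cancelʳ 0<⅛ (begin
          mass w (tabulate X) · ⅛                ≡⟨ sym (weight-eighths w X) ⟩
          weight (eighths w) X                   ≡⟨ same ⟩
          weight (eighths uniformWeight) X       ≡⟨ weight-eighths uniformWeight X ⟩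
          mass uniformWeight (tabulate X) · ⅛    ∎)))
          where w = lookup cycleWeights j
...   | inj₂ (inj₁ (k , X≡Star)) =
          ⊥-elim (X-notMaximal
            (MaximalStable-resp-≗ (sym ∘ tabulate-injective {X = X} {Star k} X≡Star) (star-maximal k)))
...   | inj₂ (inj₂ X≡∅) = ⊥-elim (subst T (tabulate-injective {X = X} {λ _ → false} X≡∅ x) x∈X)

Lᶜ-stronglyEquistable : StronglyEquistable Lᶜ
Lᶜ-stronglyEquistable = stronglyEquistable-bySeparation (eighths uniformWeight) uniform-admissible separation

Lᶜ-notGeneralPartition : ¬ GeneralPartitionGraph Lᶜ
Lᶜ-notGeneralPartition gpg = toWitnessFalse {a? = 2 ∣? 11} _
  (fixedPointFreeInvolution⇒even
    (strongClique⇒fixedPointFreeInvolution loopless star-maximal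
      (proj₂ (generalPartition⇒strongClique (# 0) gpg))))

corollary14 : StronglyEquistable (Complement (LineGraph C11-13))
            × ¬ GeneralPartitionGraph (Complement (LineGraph C11-13))
corollary14 =
  StronglyEquistable-resp-≐ (≐-sym complement-lineGraph≐Lᶜ) Lᶜ-stronglyEquistable ,
  Lᶜ-notGeneralPartition ∘ GeneralPartitionGraph-resp-≐ complement-lineGraph≐Lᶜ
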